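{- Let $n\geq 4$ be an integer and let $S(n)=\langle f_n^2, f_{n+1}^2, f_{n+2}^2\rangle=\{\alpha f_n^2+\beta f_{n+1}^2+\gamma f_{n+2}^2 \mid \alpha,\beta,\gamma\in\mathbb{N}\}$. Then $S(n)$ is a numerical semigroup and its embedding dimension is $\mathrm{e}(S(n))=3$.
   Context: $\mathbb{N}$ denotes the set of non-negative integers. The Fibonacci numbers are defined by $f_0=0$, $f_1=1$, $f_k=f_{k-1}+f_{k-2}$ for $k\geq 2$. A numerical semigroup is a submonoid of $(\mathbb{N},+)$ whose complement in $\mathbb{N}$ is finite. Every submonoid $M$ of $(\mathbb{N},+)$ has a unique minimal system of generators (a generating set no proper subset of which generates $M$); its cardinality is the embedding dimension $\mathrm{e}(M)$. -}

module Defs where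

open import Data.Nat using (ℕ; zero; suc; _+_; _*_; _≤_)
open import Data.List using (List; []; _∷_; length)
open import Data.List.Membership.Propositional using (_∈_)
open import Data.List.Relation.Unary.Unique.Propositional using (Unique)
open import Data.Product using (∃; ∃-syntax; _×_; Σ-syntax)
open import Relation.Binary.PropositionalEquality using (_≡_)

fib : ℕ → ℕ
fib zero = 0
fib (suc zero) = 1
fib (suc (suc k)) = fib (suc k) + fib k

Subsetℕ : Set₁
Subsetℕ = ℕ → Set

S : ℕ → Subsetℕ
S n x = ∃[ α ] ∃[ β ] ∃[ γ ]
  (x ≡ α * (fib n * fib n) + β * (fib (suc n) * fib (suc n))
         + γ * (fib (suc (suc n)) * fib (suc (suc n))))

IsSubmonoid : Subsetℕ → Set
IsSubmonoid M = M 0 × (∀ x y → M x → M y → M (x + y))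

-- finite complement: there is a bound beyond which every natural lies in M
-- (a subset of ℕ is finite iff it is bounded)
IsNumericalSemigroup : Subsetℕ → Set
IsNumericalSemigroup M = IsSubmonoid M × (∃[ B ] (∀ x → B ≤ x → M x))

data Generated : List ℕ → ℕ → Set where
  gen-zero : ∀ {gs} → Generated gs 0
  gen-step : ∀ {gs g x} → g ∈ gs → Generated gs x → Generated gs (g + x)

Generates : List ℕ → Subsetℕ → Set
Generates gs M = ∀ x → (Generated gs x → M x) × (M x → Generated gs x)

-- gs (duplicate-free list = finite set) is a minimal system of generators of M:
-- it generates M and no proper subset of it generates M
IsMinimalGeneratingSystem : List ℕ → Subsetℕ → Set
IsMinimalGeneratingSystem gs M =
  Unique gs × Generates gs M ×
  (∀ (hs : List ℕ) → (∀ {h} → h ∈ hs → h ∈ gs) → Generates hs M →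
     ∀ {g} → g ∈ gs → g ∈ hs)

EmbeddingDimension : Subsetℕ → ℕ → Set
EmbeddingDimension M e =
  ∃[ gs ] (IsMinimalGeneratingSystem gs M × length gs ≡ e)

{-# OPTIONS --safe #-}
module Submission where

open import Defs
open import Data.Nat using (ℕ; _≤_)
open import Data.Product using (_×_)

open import Data.Nat using (zero; suc; _+_; _*_; _∸_; _<_; z≤n; s≤s; s≤s⁻¹; NonZero; >-nonZero; _/_; _%_; _≟_)
open import Data.Nat.Properties
open import Data.Nat.DivMod using (m≡m%n+[m/n]*n; m%n<n; m*n/n≡m; /-monoˡ-≤)
open import Data.Nat.Divisibility using (_∣_; ∣1⇒≡1; divides; ∣-refl; ∣-trans; ∣m∣n⇒∣m+n; ∣m+n∣m⇒∣n; m∣m*n; ∣n⇒∣m*n; ∣⇒≤; >⇒∤; _∣0)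
open import Data.Nat.Coprimality as Coprime using (Coprime; coprime-+; coprime-divisor; coprime-Bézout)
open import Data.Nat.GCD using (module Bézout)
open import Data.Nat.Solver using (module +-*-Solver)
open +-*-Solver using (solve; _:+_; _:*_; _:=_; con)
open import Data.Product using (_,_; proj₁; proj₂; ∃-syntax)
open import Data.List using (List; []; _∷_)
open import Data.List.Membership.Propositional using (_∈_)
open import Data.List.Relation.Unary.Any using (here; there)
open import Data.List.Relation.Unary.All as All using (All; []; _∷_)
open import Data.List.Relation.Unary.AllPairs using ([]; _∷_)
open import Data.List.Relation.Unary.Unique.Propositional using (Unique)
open import Relation.Nullary using (¬_; yes; no; contradiction)
open import Relation.Binary.PropositionalEquality

-- S(n) consists of the ℕ-combinations of a = p², b = q² and c = (q + p)², where p = f_n and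
-- q = f_{n+1} are coprime with 3 ≤ p < q.  As a and b are coprime, a Bézout identity shows that
-- every large number is already a combination of a and b, so the complement is finite.
-- A generator that is not a sum of two nonzero elements lies in every generating set; for
-- a < b < c this holds as soon as a ∤ b (elements below b are multiples of a) and c ∉ ⟨a, b⟩
-- (elements below c lie in ⟨a, b⟩).  Finally (q + p)² = αp² + βq² is impossible: βq² < 4q²
-- gives β ≤ 3, reducing modulo p rules out β = 0 and gives p ∣ β − 1, so β = 1, and then
-- p ∣ 2q, i.e. p ≤ 2.

private
  variable
    a b c g k m n x y A B N : ℕ
    gs hs : List ℕ
    M : Subsetℕ

IsAtom : Subsetℕ → ℕ → Set
IsAtom M g = M g × g ≢ 0 × (∀ x y → M x → M y → x ≢ 0 → y ≢ 0 → x + y ≢ g)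

generated-∈ : g ∈ gs → Generated gs g
generated-∈ {g} g∈gs = subst (Generated _) (+-identityʳ g) (gen-step g∈gs gen-zero)

generated-+ : Generated gs x → Generated gs y → Generated gs (x + y)
generated-+ gen-zero Gy = Gy
generated-+ {y = y} (gen-step {g = g} {x = x} g∈gs Gx) Gy =
  subst (Generated _) (sym (+-assoc g x y)) (gen-step g∈gs (generated-+ Gx Gy))

generated-* : ∀ k → g ∈ gs → Generated gs (k * g)
generated-* zero    g∈gs = gen-zero
generated-* (suc k) g∈gs = gen-step g∈gs (generated-* k g∈gs)

atom∈generators : Generates hs M → IsAtom M g → g ∈ hs
atom∈generators {hs} {M} {g} generates (Mg , g≢0 , irreducible) = go (proj₂ (generates g) Mg) refl
  where
  go : Generated hs x → x ≡ g → g ∈ hs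
  go gen-zero 0≡g = contradiction (sym 0≡g) g≢0
  go (gen-step {g = h} {x = y} h∈hs Gy) h+y≡g with h ≟ 0 | y ≟ 0
  ... | yes refl | _        = go Gy h+y≡g
  ... | no _     | yes refl = subst (_∈ hs) (trans (sym (+-identityʳ h)) h+y≡g) h∈hs
  ... | no h≢0   | no y≢0   = contradiction h+y≡g
    (irreducible h y (proj₁ (generates h) (generated-∈ h∈hs)) (proj₁ (generates y) Gy) h≢0 y≢0)

atoms⇒minimal : Unique gs → Generates gs M → All (IsAtom M) gs → IsMinimalGeneratingSystem gs M
atoms⇒minimal unique generates atoms =
  unique , generates , λ hs _ generates′ g∈gs → atom∈generators generates′ (All.lookup atoms g∈gs)

Combinations : ℕ → ℕ → ℕ → Subsetℕ
Combinations a b c x = ∃[ α ] ∃[ β ] ∃[ γ ] (x ≡ α * a + β * b + γ * c)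

combinations-+ : Combinations a b c x → Combinations a b c y → Combinations a b c (x + y)
combinations-+ {a} {b} {c} (α , β , γ , refl) (α′ , β′ , γ′ , refl) =
  α + α′ , β + β′ , γ + γ′ , solve 9 (λ α β γ α′ β′ γ′ a b c →
    α :* a :+ β :* b :+ γ :* c :+ (α′ :* a :+ β′ :* b :+ γ′ :* c)
      := (α :+ α′) :* a :+ (β :+ β′) :* b :+ (γ :+ γ′) :* c) refl α β γ α′ β′ γ′ a b c

combinations-isSubmonoid : IsSubmonoid (Combinations a b c)
combinations-isSubmonoid = (0 , 0 , 0 , refl) , λ _ _ → combinations-+

generators∈combinations : All (Combinations a b c) (a ∷ b ∷ c ∷ [])
generators∈combinations {a} {b} {c} =
    (1 , 0 , 0 , solve 3 (λ a b c → a := con 1 :* a :+ con 0 :* b :+ con 0 :* c) refl a b c)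
  ∷ (0 , 1 , 0 , solve 3 (λ a b c → b := con 0 :* a :+ con 1 :* b :+ con 0 :* c) refl a b c)
  ∷ (0 , 0 , 1 , solve 3 (λ a b c → c := con 0 :* a :+ con 0 :* b :+ con 1 :* c) refl a b c)
  ∷ []

combinations-generated : Generates (a ∷ b ∷ c ∷ []) (Combinations a b c)
combinations-generated {a} {b} {c} _ = toCombination , toGenerated
  where
  toCombination : Generated (a ∷ b ∷ c ∷ []) x → Combinations a b c x
  toCombination gen-zero            = 0 , 0 , 0 , refl
  toCombination (gen-step g∈gs Gx) =
    combinations-+ (All.lookup generators∈combinations g∈gs) (toCombination Gx)

  toGenerated : Combinations a b c x → Generated (a ∷ b ∷ c ∷ []) x
  toGenerated (α , β , γ , refl) =
    generated-+ (generated-+ (generated-* α (here refl)) (generated-* β (there (here refl))))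
                (generated-* γ (there (there (here refl))))

a≤combination : ∀ α β γ → a ≤ suc α * a + β * b + γ * c
a≤combination {a} {b} {c} α β γ = ≤-trans (m≤m+n a (α * a)) (≤-trans (m≤m+n _ (β * b)) (m≤m+n _ (γ * c)))

b≤combination : ∀ α β γ → b ≤ α * a + suc β * b + γ * c
b≤combination {b} {a} {c} α β γ = ≤-trans (m≤m+n b (β * b)) (≤-trans (m≤n+m _ (α * a)) (m≤m+n _ (γ * c)))

c≤combination : ∀ α β γ → c ≤ α * a + β * b + suc γ * c
c≤combination {c} {a} {b} α β γ = ≤-trans (m≤m+n c (γ * c)) (m≤n+m _ (α * a + β * b))

summand<sum : y ≢ 0 → x + y ≡ g → x < g
summand<sum {x = x} y≢0 refl = m<m+n x (n≢0⇒n>0 y≢0)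

module _ {a b c : ℕ} (0<a : 0 < a) (a<b : a < b) (b<c : b < c)
         (a∤b : ¬ a ∣ b) (c∉⟨a,b⟩ : ∀ α β → c ≢ α * a + β * b) where

  private
    a<c : a < c
    a<c = <-trans a<b b<c

    a≤nonzero : Combinations a b c x → x ≢ 0 → a ≤ x
    a≤nonzero (suc α , β     , γ     , refl) _   = a≤combination α β γ
    a≤nonzero (0     , suc β , γ     , refl) _   = ≤-trans (<⇒≤ a<b) (b≤combination {a = a} 0 β γ)
    a≤nonzero (0     , 0     , suc γ , refl) _   = ≤-trans (<⇒≤ a<c) (c≤combination {a = a} {b = b} 0 0 γ)
    a≤nonzero (0     , 0     , 0     , refl) x≢0 = contradiction refl x≢0

    a∣below-b : Combinations a b c x → x < b → a ∣ x
    a∣below-b (α , 0     , 0     , refl) _   = divides α (trans (+-identityʳ _) (+-identityʳ _))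
    a∣below-b (α , suc β , γ     , refl) x<b = contradiction (b≤combination α β γ) (<⇒≱ x<b)
    a∣below-b (α , 0     , suc γ , refl) x<b = contradiction (c≤combination {b = b} α 0 γ) (<⇒≱ (<-trans x<b b<c))

    below-c : Combinations a b c x → x < c → ∃[ α ] ∃[ β ] (x ≡ α * a + β * b)
    below-c (α , β , 0     , refl) _   = α , β , +-identityʳ _
    below-c (α , β , suc γ , refl) x<c = contradiction (c≤combination α β γ) (<⇒≱ x<c)

    a-atom : IsAtom (Combinations a b c) a
    a-atom = All.lookup generators∈combinations (here refl) , >⇒≢ 0<a ,
      λ x y Mx _ x≢0 y≢0 x+y≡a → <⇒≱ (summand<sum y≢0 x+y≡a) (a≤nonzero Mx x≢0)

    b-atom : IsAtom (Combinations a b c) b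
    b-atom = All.lookup generators∈combinations (there (here refl)) , >⇒≢ (<-trans 0<a a<b) ,
      λ x y Mx My x≢0 y≢0 x+y≡b → a∤b (subst (a ∣_) x+y≡b (∣m∣n⇒∣m+n
        (a∣below-b Mx (summand<sum y≢0 x+y≡b))
        (a∣below-b My (summand<sum x≢0 (trans (+-comm y x) x+y≡b)))))

    c-atom : IsAtom (Combinations a b c) c
    c-atom = All.lookup generators∈combinations (there (there (here refl))) , >⇒≢ (<-trans 0<a a<c) ,
      λ x y Mx My x≢0 y≢0 x+y≡c → split (below-c Mx (summand<sum y≢0 x+y≡c))
        (below-c My (summand<sum x≢0 (trans (+-comm y x) x+y≡c))) x+y≡c
      where
      split : ∃[ α ] ∃[ β ] (x ≡ α * a + β * b) → ∃[ α ] ∃[ β ] (y ≡ α * a + β * b) → x + y ≢ c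
      split (α , β , refl) (α′ , β′ , refl) x+y≡c = c∉⟨a,b⟩ (α + α′) (β + β′) (begin
        c                                       ≡⟨ x+y≡c ⟨
        α * a + β * b + (α′ * a + β′ * b)       ≡⟨ solve 6 (λ α β α′ β′ a b →
                                                   α :* a :+ β :* b :+ (α′ :* a :+ β′ :* b)
                                                     := (α :+ α′) :* a :+ (β :+ β′) :* b) refl α β α′ β′ a b ⟩
        (α + α′) * a + (β + β′) * b             ∎)
        where open ≡-Reasoning

  combinations-minimal : IsMinimalGeneratingSystem (a ∷ b ∷ c ∷ []) (Combinations a b c)
  combinations-minimal = atoms⇒minimal
    ((<⇒≢ a<b ∷ <⇒≢ a<c ∷ []) ∷ (<⇒≢ b<c ∷ []) ∷ [] ∷ [])
    combinations-generated
    (a-atom ∷ b-atom ∷ c-atom ∷ [])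

bézout⇒representable : .{{_ : NonZero B}} → 1 + y * B ≡ x * A →
                       B * y * B ≤ N → ∃[ u ] ∃[ v ] (N ≡ u * A + v * B)
bézout⇒representable {B} {y} {x} {A} {N} bézout B*y*B≤N = r * x , d , N≡rxA+dB
  where
  r t d : ℕ
  r = N % B
  t = N / B
  d = t ∸ r * y

  r*y≤t : r * y ≤ t
  r*y≤t = begin
    r * y          ≤⟨ *-monoˡ-≤ y (<⇒≤ (m%n<n N B)) ⟩
    B * y          ≡⟨ m*n/n≡m (B * y) B ⟨
    B * y * B / B  ≤⟨ /-monoˡ-≤ B B*y*B≤N ⟩
    t              ∎
    where open ≤-Reasoning

  N≡rxA+dB : N ≡ r * x * A + d * B
  N≡rxA+dB = begin
    N                        ≡⟨ m≡m%n+[m/n]*n N B ⟩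
    r + t * B                ≡⟨ cong (λ t → r + t * B) (m+[n∸m]≡n r*y≤t) ⟨
    r + (r * y + d) * B      ≡⟨ solve 4 (λ r y d B → r :+ (r :* y :+ d) :* B := r :* (con 1 :+ y :* B) :+ d :* B)
                                  refl r y d B ⟩
    r * (1 + y * B) + d * B  ≡⟨ cong (λ z → r * z + d * B) bézout ⟩
    r * (x * A) + d * B      ≡⟨ cong (_+ d * B) (*-assoc r x A) ⟨
    r * x * A + d * B        ∎
    where open ≡-Reasoning

coprime⇒eventually-representable : .{{_ : NonZero A}} .{{_ : NonZero B}} → Coprime A B →
  ∃[ N₀ ] (∀ N → N₀ ≤ N → ∃[ u ] ∃[ v ] (N ≡ u * A + v * B))
coprime⇒eventually-representable {A} {B} coprime with coprime-Bézout coprime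
... | Bézout.+- x y bézout = B * y * B , λ _ → bézout⇒representable {x = x} bézout
... | Bézout.-+ x y bézout = A * x * A , λ N N₀≤N →
  let v , u , N≡vB+uA = bézout⇒representable {x = y} bézout N₀≤N in u , v , trans N≡vB+uA (+-comm (v * B) (u * A))

combinations-isNumericalSemigroup : 0 < a → 0 < b → Coprime a b → IsNumericalSemigroup (Combinations a b c)
combinations-isNumericalSemigroup 0<a 0<b coprime =
  let N₀ , representable = coprime⇒eventually-representable {{>-nonZero 0<a}} {{>-nonZero 0<b}} coprime
  in combinations-isSubmonoid , N₀ , λ N N₀≤N →
       let u , v , N≡ua+vb = representable N N₀≤N in u , v , 0 , trans N≡ua+vb (sym (+-identityʳ _))

coprime-*ʳ : Coprime m n → Coprime m k → Coprime m (n * k)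
coprime-*ʳ coprime-n coprime-k (i∣m , i∣nk) =
  coprime-k (i∣m , coprime-divisor (λ (j∣i , j∣n) → coprime-n (∣-trans j∣i i∣m , j∣n)) i∣nk)

coprime-square : Coprime m n → Coprime (m * m) (n * n)
coprime-square {m} {n} coprime = Coprime.sym (coprime-*ʳ coprime′ coprime′)
  where
  coprime′ : Coprime (n * n) m
  coprime′ = Coprime.sym (coprime-*ʳ coprime coprime)

module _ {p q : ℕ} (3≤p : 3 ≤ p) (p<q : p < q) (coprime : Coprime p q) where

  private
    instance
      p≢0 : NonZero p
      p≢0 = >-nonZero (≤-trans (s≤s z≤n) 3≤p)

    square-expansion : (q + p) * (q + p) ≡ p * (p + 2 * q) + q * q
    square-expansion = solve 2 (λ p q → (q :+ p) :* (q :+ p) := p :* (p :+ con 2 :* q) :+ q :* q) refl p q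

    coefficient<4 : ∀ α β → (q + p) * (q + p) ≡ α * (p * p) + β * (q * q) → β < 4
    coefficient<4 α β eq = *-cancelʳ-< (q * q) β 4 (begin-strict
      β * (q * q)                  ≤⟨ m≤n+m _ _ ⟩
      α * (p * p) + β * (q * q)    ≡⟨ eq ⟨
      (q + p) * (q + p)            <⟨ *-mono-< (+-monoʳ-< q p<q) (+-monoʳ-< q p<q) ⟩
      (q + q) * (q + q)            ≡⟨ solve 1 (λ q → (q :+ q) :* (q :+ q) := con 4 :* (q :* q)) refl q ⟩
      4 * (q * q)                  ∎)
      where open ≤-Reasoning

    cancel-q² : ∀ α k → (q + p) * (q + p) ≡ α * (p * p) + suc k * (q * q) →
                p * (p + 2 * q) ≡ α * (p * p) + k * (q * q)
    cancel-q² α k eq = +-cancelˡ-≡ (q * q) _ _ (begin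
      q * q + p * (p + 2 * q)              ≡⟨ +-comm (q * q) _ ⟩
      p * (p + 2 * q) + q * q              ≡⟨ square-expansion ⟨
      (q + p) * (q + p)                    ≡⟨ eq ⟩
      α * (p * p) + (q * q + k * (q * q))  ≡⟨ solve 3 (λ x y z → x :+ (y :+ z) := y :+ (x :+ z))
                                                refl (α * (p * p)) (q * q) (k * (q * q)) ⟩
      q * q + (α * (p * p) + k * (q * q))  ∎)
      where open ≡-Reasoning

  p∤q² : ¬ p ∣ q * q
  p∤q² p∣q² = >⇒≢ (≤-trans (s≤s (s≤s z≤n)) 3≤p) (coprime (∣-refl , coprime-divisor coprime p∣q²))

  p²∤q² : ¬ p * p ∣ q * q
  p²∤q² p²∣q² = p∤q² (∣-trans (m∣m*n p) p²∣q²)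

  [q+p]²∉⟨p²,q²⟩ : ∀ α β → (q + p) * (q + p) ≢ α * (p * p) + β * (q * q)
  [q+p]²∉⟨p²,q²⟩ α 0 eq = p∤q² (∣m+n∣m⇒∣n p∣p[p+2q]+q² (m∣m*n _))
    where
    p∣p[p+2q]+q² : p ∣ p * (p + 2 * q) + q * q
    p∣p[p+2q]+q² = subst (p ∣_) (trans (sym eq) square-expansion)
                                (∣m∣n⇒∣m+n (∣n⇒∣m*n α (m∣m*n p)) (p ∣0))
  [q+p]²∉⟨p²,q²⟩ α 1 eq = <⇒≱ 3≤p (∣⇒≤ (coprime-divisor coprime p∣q*2))
    where
    p+2q≡αp : p + 2 * q ≡ α * p
    p+2q≡αp = *-cancelˡ-≡ _ _ p (trans (cancel-q² α 0 eq)
                (solve 2 (λ α p → α :* (p :* p) :+ con 0 := p :* (α :* p)) refl α p))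
    p∣q*2 : p ∣ q * 2
    p∣q*2 = subst (p ∣_) (*-comm 2 q) (∣m+n∣m⇒∣n (divides α p+2q≡αp) ∣-refl)
  [q+p]²∉⟨p²,q²⟩ α (suc (suc k)) eq = >⇒∤ 1+k<p p∣1+k
    where
    1+k<p : suc k < p
    1+k<p = ≤-trans (s≤s⁻¹ (coefficient<4 α _ eq)) 3≤p
    p∣[1+k]*q² : p ∣ suc k * (q * q)
    p∣[1+k]*q² = ∣m+n∣m⇒∣n (subst (p ∣_) (cancel-q² α (suc k) eq) (m∣m*n _)) (∣n⇒∣m*n α (m∣m*n p))
    p∣1+k : p ∣ suc k
    p∣1+k = coprime-divisor coprime (coprime-divisor coprime
              (subst (p ∣_) (solve 2 (λ k q → k :* (q :* q) := q :* (q :* k)) refl (suc k) q) p∣[1+k]*q²))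

fib-pos : ∀ n → 0 < fib (suc n)
fib-pos zero    = ≤-refl
fib-pos (suc n) = ≤-trans (fib-pos n) (m≤m+n _ _)

fib-mono-≤ : m ≤ n → fib m ≤ fib n
fib-mono-≤ z≤n                       = z≤n
fib-mono-≤ {n = suc n} (s≤s z≤n)     = fib-pos n
fib-mono-≤ (s≤s (s≤s m≤n))           = +-mono-≤ (fib-mono-≤ (s≤s m≤n)) (fib-mono-≤ m≤n)

fib<fib-suc : 2 ≤ n → fib n < fib (suc n)
fib<fib-suc {suc (suc n)} (s≤s (s≤s _)) = m<m+n _ (fib-pos n)

fib-coprime : ∀ n → Coprime (fib n) (fib (suc n))
fib-coprime zero    (_ , i∣1) = ∣1⇒≡1 i∣1
fib-coprime (suc n) = Coprime.sym (coprime-+ (fib-coprime n))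

lemma2p5 : (n : ℕ) → 4 ≤ n → IsNumericalSemigroup (S n) × EmbeddingDimension (S n) 3
lemma2p5 n 4≤n =
    combinations-isNumericalSemigroup 0<p² (<-trans 0<p² p²<q²) (coprime-square coprime)
  , (_ , combinations-minimal 0<p² p²<q² q²<r² (p²∤q² 3≤p p<q coprime) ([q+p]²∉⟨p²,q²⟩ 3≤p p<q coprime) , refl)
  where
  p q : ℕ
  p = fib n
  q = fib (suc n)
  3≤p : 3 ≤ p
  3≤p = fib-mono-≤ 4≤n
  p<q : p < q
  p<q = fib<fib-suc (≤-trans (s≤s (s≤s z≤n)) 4≤n)
  coprime : Coprime p q
  coprime = fib-coprime n
  0<p : 0 < p
  0<p = ≤-trans (s≤s z≤n) 3≤p
  0<p² : 0 < p * p
  0<p² = *-mono-< 0<p 0<p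
  p²<q² : p * p < q * q
  p²<q² = *-mono-< p<q p<q
  q²<r² : q * q < (q + p) * (q + p)
  q²<r² = *-mono-< (m<m+n q 0<p) (m<m+n q 0<p)
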